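{- In the universal IK-CPS model $\mathcal{U}$, for every world (context) $\Gamma$ and every atomic formula $X$: if $\Gamma\Vdash X$ then $\Gamma\Vdash_s X$.
   Context: MQC is minimal intuitionistic predicate logic (natural deduction for $\wedge,\vee,\Rightarrow,\forall,\exists$ with proof terms). An IK-CPS model consists of a preorder $(K,\le)$ of worlds, a binary relation $w\Vdash_\bot^{C}$ between worlds and formulas, a monotone strong forcing relation $w\Vdash_s X$ on atomic formulas, and increasing domains $D(w)$; for a formula $A$, $w\Vdash A$ means: for every formula $C$ and every $w'\ge w$, if for all $w''\ge w'$ ($w''\Vdash_s A$ implies $w''\Vdash_\bot^{C}$), then $w'\Vdash_\bot^{C}$. The universal IK-CPS model $\mathcal{U}$ has as worlds the contexts $\Gamma$ of MQC, ordered by inclusion $\Gamma\subseteq\Gamma'$; $\Gamma\Vdash_s X$ iff there is a derivation in normal form of $\Gamma\vdash X$ in MQC ($X$ atomic); $\Gamma\Vdash_\bot^{C}$ iff there is a derivation in normal form of $\Gamma\vdash C$ in MQC; and $D(\Gamma)$ is a fixed set of individuals of MQC, independent of $\Gamma$. -}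

module Defs where

open import Data.Nat using (ℕ; suc)
open import Data.Fin using (Fin; zero; suc)
open import Data.Vec using (Vec; []; _∷_)
open import Data.List using (List; _∷_)
open import Data.List.Membership.Propositional using (_∈_)
open import Data.List.Relation.Binary.Subset.Propositional using (_⊆_)
import Data.Vec.Relation.Unary.Any as VAny
import Data.List.Relation.Unary.Any as LAny
open import Data.Product using (_×_)
open import Relation.Nullary using (¬_)
open import Data.List.Relation.Binary.Subset.Propositional.Properties using (Any-resp-⊆)
open import Data.List.Relation.Unary.Any using (here; there)

record Signature : Set₁ where
  field
    Fun    : Set
    farity : Fun → ℕ
    Pred   : Set
    parity : Pred → ℕ

-- IK-CPS models (only the data needed to interpret atomic formulas
-- is kept abstract: the type of formulas and of atoms are parameters).

record IKCPS (Formula Atom : Set) : Set₁ where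
  field
    K        : Set
    _≤_      : K → K → Set
    ≤-refl   : ∀ {w} → w ≤ w
    ≤-trans  : ∀ {w w' w''} → w ≤ w' → w' ≤ w'' → w ≤ w''
    Bot      : K → Formula → Set
    Strong   : K → Atom → Set
    Strong-mono : ∀ {w w' X} → w ≤ w' → Strong w X → Strong w' X
    D        : K → Set
    D-mono   : ∀ {w w'} → w ≤ w' → D w → D w'

  Forces : K → Atom → Set
  Forces w X = ∀ (C : Formula) (w' : K) → w ≤ w' →
    (∀ (w'' : K) → w' ≤ w'' → Strong w'' X → Bot w'' C) → Bot w' C

-- Syntax and normal-form natural deduction of MQC, over a signature.
-- Locally nameless: free variables are names (ℕ), bound variables are
-- well-scoped de Bruijn indices (Fin n).

module MQC (S : Signature) where
  open Signature S

  data Term (n : ℕ) : Set where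
    fvar : ℕ → Term n
    bvar : Fin n → Term n
    fun  : (f : Fun) → Vec (Term n) (farity f) → Term n

  infixr 6 _∧'_
  infixr 5 _∨'_
  infixr 4 _⇒_

  data Form (n : ℕ) : Set where
    atom  : (P : Pred) → Vec (Term n) (parity P) → Form n
    _∧'_  : Form n → Form n → Form n
    _∨'_  : Form n → Form n → Form n
    _⇒_   : Form n → Form n → Form n
    ∀'    : Form (suc n) → Form n
    ∃'    : Form (suc n) → Form n

  Formula : Set
  Formula = Form 0

  Individual : Set
  Individual = Term 0

  record Atom : Set where
    constructor _⟨_⟩
    field
      pred : Pred
      args : Vec Individual (parity pred)

  ⌜_⌝ : Atom → Formula
  ⌜ P ⟨ ts ⟩ ⌝ = atom P ts

  Ctx : Set
  Ctx = List Formula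

  mutual
    renT : ∀ {m n} → (Fin m → Fin n) → Term m → Term n
    renT ρ (fvar x)   = fvar x
    renT ρ (bvar i)   = bvar (ρ i)
    renT ρ (fun f ts) = fun f (renTs ρ ts)

    renTs : ∀ {m n k} → (Fin m → Fin n) → Vec (Term m) k → Vec (Term n) k
    renTs ρ []       = []
    renTs ρ (t ∷ ts) = renT ρ t ∷ renTs ρ ts

  lift : ∀ {m n} → (Fin m → Term n) → Fin (suc m) → Term (suc n)
  lift σ zero    = bvar zero
  lift σ (suc i) = renT suc (σ i)

  mutual
    subT : ∀ {m n} → (Fin m → Term n) → Term m → Term n
    subT σ (fvar x)   = fvar x
    subT σ (bvar i)   = σ i
    subT σ (fun f ts) = fun f (subTs σ ts)

    subTs : ∀ {m n k} → (Fin m → Term n) → Vec (Term m) k → Vec (Term n) k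
    subTs σ []       = []
    subTs σ (t ∷ ts) = subT σ t ∷ subTs σ ts

  subF : ∀ {m n} → (Fin m → Term n) → Form m → Form n
  subF σ (atom P ts) = atom P (subTs σ ts)
  subF σ (A ∧' B)    = subF σ A ∧' subF σ B
  subF σ (A ∨' B)    = subF σ A ∨' subF σ B
  subF σ (A ⇒ B)     = subF σ A ⇒ subF σ B
  subF σ (∀' A)      = ∀' (subF (lift σ) A)
  subF σ (∃' A)      = ∃' (subF (lift σ) A)

  inst : Form 1 → Individual → Formula
  inst A t = subF (λ { zero → t }) A

  data OccT (y : ℕ) {n : ℕ} : Term n → Set where
    here : OccT y (fvar y)
    fun  : ∀ {f ts} → VAny.Any (OccT y) ts → OccT y (fun f ts)

  data OccF (y : ℕ) {n : ℕ} : Form n → Set where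
    atom : ∀ {P ts} → VAny.Any (OccT y) ts → OccF y (atom P ts)
    ∧ˡ   : ∀ {A B} → OccF y A → OccF y (A ∧' B)
    ∧ʳ   : ∀ {A B} → OccF y B → OccF y (A ∧' B)
    ∨ˡ   : ∀ {A B} → OccF y A → OccF y (A ∨' B)
    ∨ʳ   : ∀ {A B} → OccF y B → OccF y (A ∨' B)
    ⇒ˡ   : ∀ {A B} → OccF y A → OccF y (A ⇒ B)
    ⇒ʳ   : ∀ {A B} → OccF y B → OccF y (A ⇒ B)
    all  : ∀ {A} → OccF y A → OccF y (∀' A)
    ex   : ∀ {A} → OccF y A → OccF y (∃' A)

  FreshCtx : ℕ → Ctx → Set
  FreshCtx y Γ = ¬ LAny.Any (OccF y) Γ

  FreshF : ∀ {n} → ℕ → Form n → Set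
  FreshF y A = ¬ OccF y A

  mutual
    data _⊢ne_ (Γ : Ctx) : Formula → Set where
      hyp  : ∀ {A} → A ∈ Γ → Γ ⊢ne A
      app  : ∀ {A B} → Γ ⊢ne (A ⇒ B) → Γ ⊢nf A → Γ ⊢ne B
      fst  : ∀ {A B} → Γ ⊢ne (A ∧' B) → Γ ⊢ne A
      snd  : ∀ {A B} → Γ ⊢ne (A ∧' B) → Γ ⊢ne B
      all-e : ∀ {A} → Γ ⊢ne ∀' A → (t : Individual) → Γ ⊢ne inst A t

    data _⊢nf_ (Γ : Ctx) : Formula → Set where
      ne   : ∀ {A} → Γ ⊢ne A → Γ ⊢nf A
      lam  : ∀ {A B} → (A ∷ Γ) ⊢nf B → Γ ⊢nf (A ⇒ B)
      pair : ∀ {A B} → Γ ⊢nf A → Γ ⊢nf B → Γ ⊢nf (A ∧' B)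
      inl  : ∀ {A B} → Γ ⊢nf A → Γ ⊢nf (A ∨' B)
      inr  : ∀ {A B} → Γ ⊢nf B → Γ ⊢nf (A ∨' B)
      gen  : ∀ {A} →
             (∀ (y : ℕ) → FreshCtx y Γ → FreshF y (∀' A) →
                Γ ⊢nf inst A (fvar y)) → Γ ⊢nf ∀' A
      wit  : ∀ {A} (t : Individual) → Γ ⊢nf inst A t → Γ ⊢nf ∃' A
      case : ∀ {A B C} → Γ ⊢ne (A ∨' B) →
             (A ∷ Γ) ⊢nf C → (B ∷ Γ) ⊢nf C → Γ ⊢nf C
      dest : ∀ {A C} → Γ ⊢ne ∃' A →
             (∀ (y : ℕ) → FreshCtx y Γ → FreshF y (∃' A) → FreshF y C →
                (inst A (fvar y) ∷ Γ) ⊢nf C) → Γ ⊢nf C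

  keep : ∀ {A : Formula} {Γ Γ' : Ctx} → Γ ⊆ Γ' → (A ∷ Γ) ⊆ (A ∷ Γ')
  keep p (here e)  = here e
  keep p (there x) = there (p x)

  fresh-⊆ : ∀ {y Γ Γ'} → Γ ⊆ Γ' → FreshCtx y Γ' → FreshCtx y Γ
  fresh-⊆ {y} p f o = f (Any-resp-⊆ {P = OccF y} p o)

  mutual
    wk-ne : ∀ {Γ Γ' A} → Γ ⊆ Γ' → Γ ⊢ne A → Γ' ⊢ne A
    wk-ne p (hyp x)    = hyp (p x)
    wk-ne p (app e q)  = app (wk-ne p e) (wk-nf p q)
    wk-ne p (fst e)    = fst (wk-ne p e)
    wk-ne p (snd e)    = snd (wk-ne p e)
    wk-ne p (all-e e t) = all-e (wk-ne p e) t

    wk-nf : ∀ {Γ Γ' A} → Γ ⊆ Γ' → Γ ⊢nf A → Γ' ⊢nf A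
    wk-nf p (ne e)       = ne (wk-ne p e)
    wk-nf p (lam q)      = lam (wk-nf (keep p) q)
    wk-nf p (pair q r)   = pair (wk-nf p q) (wk-nf p r)
    wk-nf p (inl q)      = inl (wk-nf p q)
    wk-nf p (inr q)      = inr (wk-nf p q)
    wk-nf p (gen k)      = gen (λ y fΓ fA → wk-nf p (k y (fresh-⊆ p fΓ) fA))
    wk-nf p (wit t q)    = wit t (wk-nf p q)
    wk-nf p (case e q r) = case (wk-ne p e) (wk-nf (keep p) q) (wk-nf (keep p) r)
    wk-nf p (dest e k)   =
      dest (wk-ne p e) (λ y fΓ fA fC → wk-nf (keep p) (k y (fresh-⊆ p fΓ) fA fC))

  𝒰 : IKCPS Formula Atom
  𝒰 = record
    { K           = Ctx
    ; _≤_         = _⊆_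
    ; ≤-refl      = λ x → x
    ; ≤-trans     = λ p q x → q (p x)
    ; Bot         = λ Γ C → Γ ⊢nf C
    ; Strong      = λ Γ X → Γ ⊢nf ⌜ X ⌝
    ; Strong-mono = weaken
    ; D           = λ _ → Individual
    ; D-mono      = λ _ t → t
    }
    where
      weaken : ∀ {Γ Γ' X} → Γ ⊆ Γ' → Γ ⊢nf ⌜ X ⌝ → Γ' ⊢nf ⌜ X ⌝
      weaken p d = wk-nf p d

module Submission where

open import Defs

-- Choosing the answer formula C to be X itself, with the identity continuation.
forces⇒bot : ∀ {Formula Atom} (M : IKCPS Formula Atom) → let open IKCPS M in
             ∀ {w} {X : Atom} (C : Formula) →
             (∀ {w'} → Strong w' X → Bot w' C) →
             Forces w X → Bot w C
forces⇒bot M C strong⇒bot f = f C _ (IKCPS.≤-refl M) (λ _ _ → strong⇒bot)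

lemma13 : (S : Signature) → let open MQC S in
    ∀ (Γ : Ctx) (X : Atom) →
    IKCPS.Forces 𝒰 Γ X → IKCPS.Strong 𝒰 Γ X
lemma13 S Γ X = forces⇒bot 𝒰 ⌜ X ⌝ (λ d → d)
  where open MQC S
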